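{- Let $n>1$ be an integer and let $L$ be a diagonal tight $\mathcal T(n)$-universal $\mathbb Z$-lattice. Writing $L=\langle a_1,\dots,a_k\rangle$ with $a_1\le a_2\le\dots\le a_k$, we have $X_n\preceq L$ or $Y_n\preceq L$, where $X_n=\langle n,n+1,\dots,2n\rangle$ and $Y_n=\langle n,n,n+1,\dots,2n-1\rangle$.
   Context: A $\mathbb Z$-lattice is a free $\mathbb Z$-module of finite rank equipped with a positive definite symmetric bilinear form with values in $\mathbb Z$; $Q(\bm x)=B(\bm x,\bm x)$. For positive integers $a_1,\dots,a_k$, $\langle a_1,\dots,a_k\rangle$ is $\mathbb Z^k$ with $Q(x)=\sum a_ix_i^2$. An integer $m$ is represented by $L$ if $m=Q(\bm x)$ for some $\bm x\in L$. $\mathcal T(n)$ is the set of integers $\ge n$; $L$ is tight $\mathcal T(n)$-universal if the set of nonzero integers represented by $L$ is exactly $\mathcal T(n)$. For diagonal lattices, $\langle u_1,\dots,u_r\rangle\preceq\langle v_1,\dots,v_s\rangle$ means that $(u_1,\dots,u_r)$ is a subsequence of $(v_1,\dots,v_s)$. -}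

module Defs where

open import Data.Nat using (ℕ; zero; suc; _+_; _*_; _≤_; _<_)
open import Data.Integer as ℤ using (ℤ; +_)
open import Data.List using (List; []; _∷_; length; upTo; map; _++_; [_])
open import Data.List.Relation.Unary.All using (All)
open import Data.List.Relation.Unary.Linked using (Linked)
open import Data.List.Relation.Binary.Sublist.Propositional using (_⊆_)
open import Data.Vec using (Vec; []; _∷_)
open import Data.Product using (∃; _×_)
open import Function.Bundles using (_⇔_)

-- A diagonal ℤ-lattice ⟨a₁,…,a_k⟩ is given by its list of diagonal entries,
-- all positive (positive definiteness).
Diagonal : Set
Diagonal = List ℕ

PositiveEntries : Diagonal → Set
PositiveEntries as = All (λ a → 0 < a) as

Q : (as : Diagonal) → Vec ℤ (length as) → ℤ
Q []       []       = + 0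
Q (a ∷ as) (x ∷ xs) = (+ a) ℤ.* (x ℤ.* x) ℤ.+ Q as xs

Represents : Diagonal → ℤ → Set
Represents as m = ∃ λ (x : Vec ℤ (length as)) → Q as x ≡ m
  where open import Relation.Binary.PropositionalEquality using (_≡_)

TightUniversal : ℕ → Diagonal → Set
TightUniversal n as =
  (m : ℤ) → (¬ (m ≡ + 0) × Represents as m) ⇔ (+ n ℤ.≤ m)
  where
    open import Relation.Binary.PropositionalEquality using (_≡_)
    open import Relation.Nullary using (¬_)

Sorted : Diagonal → Set
Sorted = Linked _≤_

range : ℕ → ℕ → List ℕ
range n j = map (λ i → n + i) (upTo j)

X : ℕ → Diagonal
X n = range n (suc n)

Y : ℕ → Diagonal
Y n = n ∷ range n n

_≼_ : Diagonal → Diagonal → Set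
u ≼ v = u ⊆ v

-- Every entry a of L is represented and nonzero, so a ≥ n.  A value m < 2n is a
-- sum Σ aᵢxᵢ² of entries ≥ n, so exactly one xᵢ is ±1 and m is itself an entry;
-- the value 2n is either an entry or the sum n + n of two distinct entries.  So
-- L contains n, n+1, …, 2n−1 and moreover 2n or a second n; since L is sorted,
-- these values appear in it as the subsequence X_n, respectively Y_n.
module Submission where

open import Defs
open import Data.Nat using (ℕ; suc; _+_; _*_; _≤_; _<_; z≤n; s≤s; s≤s⁻¹; >-nonZero)
open import Data.Nat.Properties
open import Data.Integer as ℤ using (-[1+_]; ∣_∣)
import Data.Integer.Properties as ℤ
open import Data.List using (List; []; _∷_; length)
open import Data.List.Membership.Propositional using (_∈_)
open import Data.List.Relation.Unary.All as All using (All; []; _∷_)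
open import Data.List.Relation.Unary.All.Properties using (all-upTo)
import Data.List.Relation.Unary.All.Properties as All
open import Data.List.Relation.Unary.AllPairs using (AllPairs; []; _∷_)
open import Data.List.Relation.Unary.Any using (here; there)
import Data.List.Relation.Unary.Linked as Linked
open import Data.List.Relation.Unary.Linked.Properties using (Linked⇒All; Linked⇒AllPairs)
import Data.List.Relation.Unary.Linked.Properties as Linked
open import Data.List.Relation.Binary.Sublist.Propositional
  using (_⊆_; []; _∷_; _∷ʳ_; minimum; to∈; from∈)
open import Data.Vec using (Vec; []; _∷_)
import Data.Vec as Vec
import Data.Vec.Properties as Vec
open import Data.Product using (∃; _×_; _,_; proj₁; proj₂; map₂)
open import Data.Sum as Sum using (_⊎_; inj₁; inj₂)
open import Function using (_∘′_)
open import Function.Bundles using (_⇔_; mk⇔; Equivalence)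
open import Relation.Nullary using (contradiction)
open import Relation.Binary.PropositionalEquality

Qℕ : (as : Diagonal) → Vec ℕ (length as) → ℕ
Qℕ []       []       = 0
Qℕ (a ∷ as) (y ∷ ys) = a * (y * y) + Qℕ as ys

Representsℕ : Diagonal → ℕ → Set
Representsℕ as m = ∃ λ (y : Vec ℕ (length as)) → Qℕ as y ≡ m

OccursTwice : ℕ → Diagonal → Set
OccursTwice n as = n ∷ n ∷ [] ⊆ as

*-self≡∣∣*∣∣ : ∀ x → x ℤ.* x ≡ ℤ.+ (∣ x ∣ * ∣ x ∣)
*-self≡∣∣*∣∣ (ℤ.+ k)  = sym (ℤ.pos-* k k)
*-self≡∣∣*∣∣ -[1+ k ] = refl

Q≡Qℕ∘∣∣ : ∀ as x → Q as x ≡ ℤ.+ Qℕ as (Vec.map ∣_∣ x)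
Q≡Qℕ∘∣∣ []       []       = refl
Q≡Qℕ∘∣∣ (a ∷ as) (x ∷ xs) = cong₂ ℤ._+_ head-term (Q≡Qℕ∘∣∣ as xs)
  where
  head-term : ℤ.+ a ℤ.* (x ℤ.* x) ≡ ℤ.+ (a * (∣ x ∣ * ∣ x ∣))
  head-term = trans (cong (ℤ.+ a ℤ.*_) (*-self≡∣∣*∣∣ x)) (sym (ℤ.pos-* a _))

Represents⇔Representsℕ : ∀ as m → Represents as (ℤ.+ m) ⇔ Representsℕ as m
Represents⇔Representsℕ as m = mk⇔
  (λ (x , Qx≡m) → Vec.map ∣_∣ x , ℤ.+-injective (trans (sym (Q≡Qℕ∘∣∣ as x)) Qx≡m))
  (λ (y , Qy≡m) → Vec.map ℤ.+_ y , (begin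
    Q as (Vec.map ℤ.+_ y)                      ≡⟨ Q≡Qℕ∘∣∣ as (Vec.map ℤ.+_ y) ⟩
    ℤ.+ Qℕ as (Vec.map ∣_∣ (Vec.map ℤ.+_ y))  ≡⟨ cong (ℤ.+_ ∘′ Qℕ as) ∣∣∘+≗id ⟩
    ℤ.+ Qℕ as y                                ≡⟨ cong ℤ.+_ Qy≡m ⟩
    ℤ.+ m                                      ∎))
  where
  open ≡-Reasoning
  ∣∣∘+≗id : ∀ {k} {y : Vec ℕ k} → Vec.map ∣_∣ (Vec.map ℤ.+_ y) ≡ y
  ∣∣∘+≗id {y = y} = trans (sym (Vec.map-∘ ∣_∣ ℤ.+_ y)) (Vec.map-id y)

∈⇒Representsℕ : ∀ {a as} → a ∈ as → Representsℕ as a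
∈⇒Representsℕ {a} {_ ∷ as} (here refl) = 1 ∷ Vec.replicate _ 0 , (begin
  a * 1 + Qℕ as (Vec.replicate _ 0) ≡⟨ cong₂ _+_ (*-identityʳ a) (Qℕ-zero as) ⟩
  a + 0                             ≡⟨ +-identityʳ a ⟩
  a                                 ∎)
  where
  open ≡-Reasoning
  Qℕ-zero : ∀ bs → Qℕ bs (Vec.replicate (length bs) 0) ≡ 0
  Qℕ-zero []       = refl
  Qℕ-zero (b ∷ bs) = trans (cong (_+ Qℕ bs (Vec.replicate (length bs) 0)) (*-zeroʳ b)) (Qℕ-zero bs)
∈⇒Representsℕ {a} {b ∷ as} (there a∈as) =
  let (y , Qy≡a) = ∈⇒Representsℕ a∈as
  in 0 ∷ y , trans (cong (_+ Qℕ as y) (*-zeroʳ b)) Qy≡a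

m+m<m*[y*y] : ∀ {m y} → 0 < m → 2 ≤ y → m + m < m * (y * y)
m+m<m*[y*y] {m} {y} 0<m 2≤y = begin-strict
  m + m        ≡⟨ cong (m +_) (*-identityʳ m) ⟨
  m + m * 1    ≡⟨ *-suc m 1 ⟨
  m * 2        <⟨ *-monoʳ-< m {{>-nonZero 0<m}} (<-≤-trans 2<4 (*-mono-≤ 2≤y 2≤y)) ⟩
  m * (y * y)  ∎
  where
  open ≤-Reasoning
  2<4 : 2 < 4
  2<4 = s≤s (s≤s (s≤s z≤n))

+-squeeze : ∀ {n a b} → n ≤ a → n ≤ b → a + b ≤ n + n → a ≡ n × b ≡ n
+-squeeze {n} {a} {b} n≤a n≤b a+b≤n+n =
  ≤-antisym (+-cancelʳ-≤ b a n (≤-trans a+b≤n+n (+-monoʳ-≤ n n≤b))) n≤a ,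
  ≤-antisym (+-cancelˡ-≤ a b n (≤-trans a+b≤n+n (+-monoˡ-≤ n n≤a))) n≤b

Qℕ-≥ : ∀ {n as} → All (n ≤_) as → ∀ y → 0 < Qℕ as y → n ≤ Qℕ as y
Qℕ-≥ {as = []}     []         []           ()
Qℕ-≥ {as = a ∷ as} (_   ∷ ≥n) (0 ∷ ys)     0<Q rewrite *-zeroʳ a = Qℕ-≥ ≥n ys 0<Q
Qℕ-≥ {as = a ∷ as} (n≤a ∷ _)  (suc k ∷ ys) _ =
  ≤-trans n≤a (≤-trans (m≤m*n a (suc k * suc k)) (m≤m+n _ _))

module _ {n : ℕ} (0<n : 0 < n) where

  Qℕ≤n+n⇒∈⊎OccursTwice : ∀ {as} → All (n ≤_) as → ∀ y → 0 < Qℕ as y → Qℕ as y ≤ n + n →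
                          Qℕ as y ∈ as ⊎ (Qℕ as y ≡ n + n × OccursTwice n as)
  Qℕ≤n+n⇒∈⊎OccursTwice {[]}     []         []       () _
  Qℕ≤n+n⇒∈⊎OccursTwice {a ∷ as} (_ ∷ ≥n) (0 ∷ ys) 0<Q Q≤n+n rewrite *-zeroʳ a =
    Sum.map there (map₂ (a ∷ʳ_)) (Qℕ≤n+n⇒∈⊎OccursTwice ≥n ys 0<Q Q≤n+n)
  Qℕ≤n+n⇒∈⊎OccursTwice {a ∷ as} (n≤a ∷ ≥n) (1 ∷ ys) _ Q≤n+n
    rewrite *-identityʳ a with Qℕ as ys in Qys≡1+r
  ... | 0     = inj₁ (here (+-identityʳ a))
  ... | suc r = inj₂ (cong₂ _+_ a≡n 1+r≡n , sym a≡n ∷ from∈ n∈as)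
    where
    0<Qys : 0 < Qℕ as ys
    0<Qys = subst (0 <_) (sym Qys≡1+r) (s≤s z≤n)
    squeezed : a ≡ n × suc r ≡ n
    squeezed = +-squeeze n≤a (subst (n ≤_) Qys≡1+r (Qℕ-≥ ≥n ys 0<Qys)) Q≤n+n
    a≡n : a ≡ n
    a≡n = proj₁ squeezed
    1+r≡n : suc r ≡ n
    1+r≡n = proj₂ squeezed
    Qys≡n : Qℕ as ys ≡ n
    Qys≡n = trans Qys≡1+r 1+r≡n
    n∈as : n ∈ as
    n∈as with Qℕ≤n+n⇒∈⊎OccursTwice ≥n ys 0<Qys (subst (_≤ n + n) (sym Qys≡n) (m≤m+n n n))
    ... | inj₁ Qys∈as        = subst (_∈ as) Qys≡n Qys∈as
    ... | inj₂ (Qys≡n+n , _) = contradiction (trans (sym Qys≡n) Qys≡n+n) (<⇒≢ (m<m+n n 0<n))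
  Qℕ≤n+n⇒∈⊎OccursTwice {a ∷ as} (n≤a ∷ _) (suc (suc k) ∷ ys) _ Q≤n+n =
    contradiction Q≤n+n (<⇒≱ (begin-strict
      n + n                           ≤⟨ +-mono-≤ n≤a n≤a ⟩
      a + a                           <⟨ m+m<m*[y*y] (<-≤-trans 0<n n≤a) (s≤s (s≤s z≤n)) ⟩
      a * (suc (suc k) * suc (suc k)) ≤⟨ m≤m+n _ _ ⟩
      Qℕ (a ∷ as) (suc (suc k) ∷ ys)  ∎))
    where open ≤-Reasoning

  Representsℕ<n+n⇒∈ : ∀ {as m} → All (n ≤_) as → Representsℕ as m → 0 < m → m < n + n → m ∈ as
  Representsℕ<n+n⇒∈ ≥n (y , refl) 0<m m<n+n with Qℕ≤n+n⇒∈⊎OccursTwice ≥n y 0<m (<⇒≤ m<n+n)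
  ... | inj₁ m∈as        = m∈as
  ... | inj₂ (m≡n+n , _) = contradiction m≡n+n (<⇒≢ m<n+n)

  Representsℕ[n+n]⇒∈⊎OccursTwice : ∀ {as} → All (n ≤_) as → Representsℕ as (n + n) →
                                    n + n ∈ as ⊎ OccursTwice n as
  Representsℕ[n+n]⇒∈⊎OccursTwice {as} ≥n (y , Qy≡n+n) =
    Sum.map (subst (_∈ as) Qy≡n+n) proj₂
      (Qℕ≤n+n⇒∈⊎OccursTwice ≥n y (subst (0 <_) (sym Qy≡n+n) 0<n+n) (≤-reflexive Qy≡n+n))
    where
    0<n+n : 0 < n + n
    0<n+n = <-≤-trans 0<n (m≤m+n n n)

module Tight {n : ℕ} {as : Diagonal} (tight : TightUniversal n as) where

  TightUniversal⇒Representsℕ : ∀ {m} → n ≤ m → Representsℕ as m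
  TightUniversal⇒Representsℕ {m} n≤m =
    Equivalence.to (Represents⇔Representsℕ as m)
      (proj₂ (Equivalence.from (tight (ℤ.+ m)) (ℤ.+≤+ n≤m)))

  TightUniversal⇒All≥ : PositiveEntries as → All (n ≤_) as
  TightUniversal⇒All≥ positive = All.tabulate λ {a} a∈as →
    ℤ.drop‿+≤+ (Equivalence.to (tight (ℤ.+ a))
      ( (λ a≡0 → <⇒≢ (All.lookup positive a∈as) (sym (ℤ.+-injective a≡0)))
      , Equivalence.from (Represents⇔Representsℕ as a) (∈⇒Representsℕ a∈as)))

Sorted⇒All-head≤ : ∀ {a as} → Sorted (a ∷ as) → All (a ≤_) (a ∷ as)
Sorted⇒All-head≤ = Linked⇒All ≤-trans ≤-refl

∈-∷⁻-< : ∀ {a x} {as : List ℕ} → a < x → x ∈ a ∷ as → x ∈ as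
∈-∷⁻-< a<a (here refl) = contradiction a<a (<-irrefl refl)
∈-∷⁻-< _   (there x∈as) = x∈as

∈-∷-dedup : ∀ {a x} {as : List ℕ} → x ∈ a ∷ a ∷ as → x ∈ a ∷ as
∈-∷-dedup (here x≡a) = here x≡a
∈-∷-dedup (there x∈) = x∈

AllPairs<⇒⊆ : ∀ {as bs} → Sorted as → AllPairs _<_ bs → All (_∈ as) bs → bs ⊆ as
AllPairs<⇒⊆ {as} _ [] [] = minimum as
AllPairs<⇒⊆ {a ∷ as} sorted (b<bs ∷ bs<) (here refl ∷ bs∈) =
  refl ∷ AllPairs<⇒⊆ (Linked.tail sorted) bs< (All.zipWith (λ (x∈ , a<x) → ∈-∷⁻-< a<x x∈) (bs∈ , b<bs))
AllPairs<⇒⊆ {a ∷ as} sorted (b<bs ∷ bs<) (there b∈as ∷ bs∈) =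
  a ∷ʳ AllPairs<⇒⊆ (Linked.tail sorted) (b<bs ∷ bs<)
         (b∈as ∷ All.zipWith (λ (x∈ , b<x) → ∈-∷⁻-< (≤-<-trans a≤b b<x) x∈) (bs∈ , b<bs))
  where
  a≤b : a ≤ _
  a≤b = All.lookup (Sorted⇒All-head≤ sorted) (there b∈as)

OccursTwice⇒∈-tail : ∀ {n a as} → OccursTwice n (a ∷ as) → n ∈ as
OccursTwice⇒∈-tail (_ ∷ʳ twice) = to∈ twice
OccursTwice⇒∈-tail (_ ∷  once)  = to∈ once

OccursTwice⇒prefix : ∀ {n as} → Sorted as → All (n ≤_) as → OccursTwice n as →
                     ∃ λ bs → as ≡ n ∷ n ∷ bs
OccursTwice⇒prefix {n} {a ∷ b ∷ bs} sorted (n≤a ∷ n≤b ∷ _) twice =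
  bs , cong₂ (λ x y → x ∷ y ∷ bs) a≡n b≡n
  where
  n∈b∷bs : n ∈ b ∷ bs
  n∈b∷bs = OccursTwice⇒∈-tail twice
  a≡n : a ≡ n
  a≡n = ≤-antisym (All.lookup (Sorted⇒All-head≤ sorted) (there n∈b∷bs)) n≤a
  b≡n : b ≡ n
  b≡n = ≤-antisym (All.lookup (Sorted⇒All-head≤ (Linked.tail sorted)) n∈b∷bs) n≤b
OccursTwice⇒prefix {as = []}    _ _ ()
OccursTwice⇒prefix {as = _ ∷ []} _ _ (_ ∷ʳ ())
OccursTwice⇒prefix {as = _ ∷ []} _ _ (_ ∷ ())

range-AllPairs< : ∀ n j → AllPairs _<_ (range n j)
range-AllPairs< n j = Linked⇒AllPairs <-trans
  (Linked.map⁺ (Linked.applyUpTo⁺₂ (λ i → i) j (λ i → +-monoʳ-< n (n<1+n i))))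

range-bounds : ∀ n j → All (λ m → n ≤ m × m < n + j) (range n j)
range-bounds n j = All.map⁺ (All.map (λ {i} i<j → m≤m+n n i , +-monoʳ-< n i<j) (all-upTo j))

X≼ : ∀ {n as} → Sorted as → (∀ {m} → n ≤ m → m ≤ n + n → m ∈ as) → X n ≼ as
X≼ {n} sorted ∈as = AllPairs<⇒⊆ sorted (range-AllPairs< n (suc n))
  (All.map (λ {m} (n≤m , m<) → ∈as n≤m (s≤s⁻¹ (subst (m <_) (+-suc n n) m<))) (range-bounds n (suc n)))

Y≼ : ∀ {n as} → Sorted as → All (n ≤_) as → OccursTwice n as →
     (∀ {m} → n ≤ m → m < n + n → m ∈ as) → Y n ≼ as
Y≼ {n} sorted ≥n twice ∈as with OccursTwice⇒prefix sorted ≥n twice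
... | bs , refl = refl ∷ AllPairs<⇒⊆ (Linked.tail sorted) (range-AllPairs< n n)
  (All.map (λ (n≤m , m<n+n) → ∈-∷-dedup (∈as n≤m m<n+n)) (range-bounds n n))

proposition2p3 : (n : ℕ) → 1 < n → (L : Diagonal) → PositiveEntries L → Sorted L →
    TightUniversal n L → (X n ≼ L) ⊎ (Y n ≼ L)
proposition2p3 n 1<n L positive sorted tight =
  Sum.map (λ n+n∈L → X≼ sorted (≤n+n⇒∈ n+n∈L)) (λ twice → Y≼ sorted ≥n twice <n+n⇒∈)
    (Representsℕ[n+n]⇒∈⊎OccursTwice 0<n ≥n (TightUniversal⇒Representsℕ (m≤m+n n n)))
  where
  open Tight {n} {L} tight
  0<n : 0 < n
  0<n = <-trans (s≤s z≤n) 1<n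
  ≥n : All (n ≤_) L
  ≥n = TightUniversal⇒All≥ positive
  <n+n⇒∈ : ∀ {m} → n ≤ m → m < n + n → m ∈ L
  <n+n⇒∈ n≤m = Representsℕ<n+n⇒∈ 0<n ≥n (TightUniversal⇒Representsℕ n≤m) (<-≤-trans 0<n n≤m)
  ≤n+n⇒∈ : n + n ∈ L → ∀ {m} → n ≤ m → m ≤ n + n → m ∈ L
  ≤n+n⇒∈ n+n∈L n≤m m≤n+n with m≤n⇒m<n∨m≡n m≤n+n
  ... | inj₁ m<n+n = <n+n⇒∈ n≤m m<n+n
  ... | inj₂ refl  = n+n∈L
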